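{- For any two integers $n \ge p \ge 0$, $$\sum_{k=p}^n S(n,k)\,L(k,p)\,(-1)^k \;=\; (-1)^p\sum_{k=p}^n \binom{n}{k} S(k,p)\, p^{n-k}(-1)^{n-k},$$ and also $$S(n,p) \;=\; (-1)^p\sum_{k=p}^n \binom{n}{k} S(k,p)\, p^{n-k}(-1)^k,$$ with the convention $0^0=1$.
   Context: $S(n,k)$ denotes the Stirling numbers of the second kind, defined by $\frac{1}{p!}(e^x-1)^p = \sum_{n\ge0} S(n,p)\frac{x^n}{n!}$. The Lah numbers $L(n,k)$ are defined by $\frac{1}{p!}\left(\frac{x}{1-x}\right)^p = \sum_{n\ge0} L(n,p)\frac{x^n}{n!}$; explicitly $L(0,0)=1$, $L(n,0)=0$ for $n>0$, $L(n,k)=0$ for $n<k$, and $L(n,k)=\frac{n!}{k!}\binom{n-1}{k-1}$ for $n\ge k\ge1$. -}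

module Defs where

open import Data.Nat using (ℕ; zero; suc; _+_; _*_; _∸_; _!; _/_)
open import Data.Nat.Properties using (_!≢0)
open import Data.Nat.Combinatorics using (_C_)
open import Data.Integer using (ℤ; +_)
import Data.Integer as ℤ

-- Stirling numbers of the second kind S(n,k), via the standard recurrence
-- (equivalent to the exponential generating function of the context).
S : ℕ → ℕ → ℕ
S zero    zero    = 1
S zero    (suc k) = 0
S (suc n) zero    = 0
S (suc n) (suc k) = suc k * S n (suc k) + S n k

-- Lah numbers, by the explicit formula of the context:
-- L(0,0)=1, L(n,0)=0 (n>0), L(n,k)=0 (n<k), L(n,k) = n!/k! * C(n-1,k-1) (n≥k≥1).
-- (For n<k, n!/k! = 0 and C(n-1,k-1) = 0 anyway, so the formula covers it.)
L : ℕ → ℕ → ℕ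
L zero    zero    = 1
L (suc n) zero    = 0
L zero    (suc k) = 0
L (suc n) (suc k) = ((suc n ! / suc k !) {{suc k !≢0}}) * (n C k)

sgn : ℕ → ℤ
sgn zero    = + 1
sgn (suc k) = ℤ.- sgn k

-- Σ_{k=a}^{b} f k  (empty, i.e. 0, when b < a)
sumFromTo : ℕ → ℕ → (ℕ → ℤ) → ℤ
sumFromTo a b f = go (suc b ∸ a)
  where
  go : ℕ → ℤ
  go zero    = + 0
  go (suc m) = go m ℤ.+ f (a + m)

-- The sums Σₖ S(n,k) L(k,p) (-1)ᵏ obey the Stirling recurrence up to the sign (-1)ⁿ,
-- because S(n+1,k) = k S(n,k) + S(n,k-1) and L(k+1,q+1) = (k+q+1) L(k,q+1) + L(k,q);
-- hence they equal (-1)ⁿ S(n,p).  The sums Rₓ(n,p) = Σₖ C(n,k) S(k,p) xⁿ⁻ᵏ obey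
-- Rₓ(n+1,q+1) = (x+q+1) Rₓ(n,q+1) + Rₓ(n,q), which gives the finite-difference formula
-- p! Rₓ(n,p) = Σⱼ (-1)ʲ C(p,j) (x+p-j)ⁿ.  Reflecting j ↦ p-j in it relates x = 0 to x = -p:
-- S(n,p) = R₀(n,p) = (-1)ⁿ⁺ᵖ R₋ₚ(n,p).  Both identities are rewritings of these two facts.
module Submission where

open import Defs
open import Data.Nat using (ℕ; _≤_; _∸_; _^_)
open import Data.Nat.Combinatorics using (_C_)
open import Data.Integer using (ℤ; +_; _*_)
open import Data.Product using (_×_)
open import Relation.Binary.PropositionalEquality using (_≡_)

open import Data.Nat using (zero; suc; _<_; s≤s; _!)
import Data.Nat as ℕ
import Data.Nat.Properties as ℕ
open import Data.Nat.Properties using (_!≢0)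
open import Data.Nat.Combinatorics
  using (k>n⇒nCk≡0; nCn≡1; nC1≡n; nCk≡nC[n∸k]; nCk+nC[k+1]≡[n+1]C[k+1])
open import Data.Nat.DivMod using (_/_; m*[n/m]≡n; n/1≡n)
open import Data.Nat.Divisibility using (m≤n⇒m!∣n!)
open import Data.Integer using (_+_; -_; _-_)
import Data.Integer as ℤ
import Data.Integer.Properties as ℤ
open import Data.Integer.Tactic.RingSolver using (solve-∀)
import Data.Nat.Tactic.RingSolver as ℕ-Solver
open import Data.Product using (_,_)
open import Data.Sum using (inj₁; inj₂)
open import Relation.Nullary using (yes; no)
open import Relation.Binary.PropositionalEquality
  using (refl; sym; trans; cong; cong₂; module ≡-Reasoning)

open ≡-Reasoning

∑ : ℕ → (ℕ → ℤ) → ℤ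
∑ zero    f = + 0
∑ (suc n) f = ∑ n f + f n

∑-cong< : ∀ n {f g : ℕ → ℤ} → (∀ i → i < n → f i ≡ g i) → ∑ n f ≡ ∑ n g
∑-cong< zero    eq = refl
∑-cong< (suc n) eq =
  cong₂ _+_ (∑-cong< n (λ i i<n → eq i (ℕ.m<n⇒m<1+n i<n))) (eq n (ℕ.n<1+n n))

∑-cong : ∀ n {f g : ℕ → ℤ} → (∀ i → f i ≡ g i) → ∑ n f ≡ ∑ n g
∑-cong n eq = ∑-cong< n (λ i _ → eq i)

∑-zero : ∀ n (f : ℕ → ℤ) → (∀ i → i < n → f i ≡ + 0) → ∑ n f ≡ + 0
∑-zero zero    f eq = refl
∑-zero (suc n) f eq =
  cong₂ _+_ (∑-zero n f (λ i i<n → eq i (ℕ.m<n⇒m<1+n i<n))) (eq n (ℕ.n<1+n n))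

∑-distrib-+ : ∀ n (f g : ℕ → ℤ) → ∑ n (λ i → f i + g i) ≡ ∑ n f + ∑ n g
∑-distrib-+ zero    f g = refl
∑-distrib-+ (suc n) f g = begin
  ∑ n (λ i → f i + g i) + (f n + g n) ≡⟨ cong (_+ (f n + g n)) (∑-distrib-+ n f g) ⟩
  (∑ n f + ∑ n g) + (f n + g n)       ≡⟨ interchange (∑ n f) (∑ n g) (f n) (g n) ⟩
  (∑ n f + f n) + (∑ n g + g n)       ∎
  where
  interchange : ∀ (a b c d : ℤ) → (a + b) + (c + d) ≡ (a + c) + (b + d)
  interchange = solve-∀

*-distribˡ-∑ : ∀ n (c : ℤ) (f : ℕ → ℤ) → ∑ n (λ i → c * f i) ≡ c * ∑ n f
*-distribˡ-∑ zero    c f = sym (ℤ.*-zeroʳ c)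
*-distribˡ-∑ (suc n) c f =
  trans (cong (_+ c * f n) (*-distribˡ-∑ n c f)) (sym (ℤ.*-distribˡ-+ c (∑ n f) (f n)))

neg-distrib-∑ : ∀ n (f : ℕ → ℤ) → ∑ n (λ i → - f i) ≡ - ∑ n f
neg-distrib-∑ n f = begin
  ∑ n (λ i → - f i)         ≡⟨ ∑-cong n (λ i → sym (ℤ.-1*i≡-i (f i))) ⟩
  ∑ n (λ i → ℤ.-1ℤ * f i)   ≡⟨ *-distribˡ-∑ n ℤ.-1ℤ f ⟩
  ℤ.-1ℤ * ∑ n f             ≡⟨ ℤ.-1*i≡-i (∑ n f) ⟩
  - ∑ n f                   ∎

∑-suc : ∀ n (f : ℕ → ℤ) → ∑ (suc n) f ≡ f 0 + ∑ n (λ i → f (suc i))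
∑-suc zero    f = trans (ℤ.+-identityˡ (f 0)) (sym (ℤ.+-identityʳ (f 0)))
∑-suc (suc n) f =
  trans (cong (_+ f (suc n)) (∑-suc n f)) (ℤ.+-assoc (f 0) _ (f (suc n)))

∑-dropLast : ∀ n (f : ℕ → ℤ) → f n ≡ + 0 → ∑ (suc n) f ≡ ∑ n f
∑-dropLast n f fn≡0 = trans (cong (λ x → ∑ n f + x) fn≡0) (ℤ.+-identityʳ (∑ n f))

∑-reverse : ∀ p (f : ℕ → ℤ) → ∑ (suc p) f ≡ ∑ (suc p) (λ j → f (p ∸ j))
∑-reverse zero    f = refl
∑-reverse (suc p) f = begin
  ∑ (suc (suc p)) f                          ≡⟨ ∑-suc (suc p) f ⟩
  f 0 + ∑ (suc p) (λ i → f (suc i))          ≡⟨ cong (λ x → f 0 + x) (∑-reverse p (λ i → f (suc i))) ⟩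
  f 0 + ∑ (suc p) (λ j → f (suc (p ∸ j)))    ≡⟨ cong (λ x → f 0 + x) (∑-cong< (suc p) suc-∸) ⟩
  f 0 + ∑ (suc p) (λ j → f (suc p ∸ j))      ≡⟨ ℤ.+-comm (f 0) _ ⟩
  ∑ (suc p) (λ j → f (suc p ∸ j)) + f 0      ≡⟨ cong (λ i → ∑ (suc p) (λ j → f (suc p ∸ j)) + f i) (ℕ.n∸n≡0 p) ⟨
  ∑ (suc (suc p)) (λ j → f (suc p ∸ j))      ∎
  where
  suc-∸ : ∀ j → j < suc p → f (suc (p ∸ j)) ≡ f (suc p ∸ j)
  suc-∸ j (s≤s j≤p) = cong f (sym (ℕ.+-∸-assoc 1 j≤p))

∑-telescope : ∀ n (f : ℕ → ℤ) → ∑ n (λ i → f (suc i) - f i) ≡ f n - f 0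
∑-telescope zero    f = sym (ℤ.+-inverseʳ (f 0))
∑-telescope (suc n) f = begin
  ∑ n (λ i → f (suc i) - f i) + (f (suc n) - f n) ≡⟨ cong (_+ (f (suc n) - f n)) (∑-telescope n f) ⟩
  (f n - f 0) + (f (suc n) - f n)                 ≡⟨ cancel (f 0) (f n) (f (suc n)) ⟩
  f (suc n) - f 0                                 ∎
  where
  cancel : ∀ (a b c : ℤ) → (b - a) + (c - b) ≡ c - a
  cancel = solve-∀

sumFromTo-snoc : ∀ a b (f : ℕ → ℤ) → a ≤ suc b →
                 sumFromTo a (suc b) f ≡ sumFromTo a b f + f (suc b)
sumFromTo-snoc zero    b f a≤1+b     = refl
sumFromTo-snoc (suc a) b f (s≤s a≤b) rewrite ℕ.+-∸-assoc 1 a≤b =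
  cong (λ i → sumFromTo (suc a) b f + f (suc i)) (ℕ.m+[n∸m]≡n a≤b)

sumFromTo-singleton : ∀ p (f : ℕ → ℤ) → sumFromTo p p f ≡ f p
sumFromTo-singleton zero    f = ℤ.+-identityˡ (f 0)
sumFromTo-singleton (suc p) f rewrite ℕ.+-∸-assoc 1 (ℕ.≤-refl {p}) | ℕ.n∸n≡0 p =
  trans (ℤ.+-identityˡ _) (cong (λ i → f (suc i)) (ℕ.+-identityʳ p))

sumFromTo≡∑ : ∀ p n (f : ℕ → ℤ) → p ≤ n → (∀ i → i < p → f i ≡ + 0) →
              sumFromTo p n f ≡ ∑ (suc n) f
sumFromTo≡∑ p zero    f ℕ.z≤n vanish = refl
sumFromTo≡∑ p (suc n) f p≤1+n vanish with ℕ.m≤n⇒m<n∨m≡n p≤1+n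
... | inj₁ (s≤s p≤n) = begin
  sumFromTo p (suc n) f         ≡⟨ sumFromTo-snoc p n f (ℕ.m≤n⇒m≤1+n p≤n) ⟩
  sumFromTo p n f + f (suc n)   ≡⟨ cong (_+ f (suc n)) (sumFromTo≡∑ p n f p≤n vanish) ⟩
  ∑ (suc (suc n)) f             ∎
... | inj₂ refl = begin
  sumFromTo (suc n) (suc n) f   ≡⟨ sumFromTo-singleton (suc n) f ⟩
  f (suc n)                     ≡⟨ ℤ.+-identityˡ (f (suc n)) ⟨
  + 0 + f (suc n)               ≡⟨ cong (_+ f (suc n)) (∑-zero (suc n) f vanish) ⟨
  ∑ (suc (suc n)) f             ∎

sgn-+ : ∀ m n → sgn (m ℕ.+ n) ≡ sgn m * sgn n
sgn-+ zero    n = sym (ℤ.*-identityˡ (sgn n))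
sgn-+ (suc m) n = trans (cong -_ (sgn-+ m n)) (ℤ.neg-distribˡ-* (sgn m) (sgn n))

sgn*sgn≡1 : ∀ n → sgn n * sgn n ≡ + 1
sgn*sgn≡1 zero    = refl
sgn*sgn≡1 (suc n) = trans (neg*neg (sgn n)) (sgn*sgn≡1 n)
  where
  neg*neg : ∀ (s : ℤ) → (- s) * (- s) ≡ s * s
  neg*neg = solve-∀

sgn-cancel : ∀ n (x : ℤ) → sgn n * (sgn n * x) ≡ x
sgn-cancel n x = begin
  sgn n * (sgn n * x) ≡⟨ ℤ.*-assoc (sgn n) (sgn n) x ⟨
  sgn n * sgn n * x   ≡⟨ cong (_* x) (sgn*sgn≡1 n) ⟩
  + 1 * x             ≡⟨ ℤ.*-identityˡ x ⟩
  x                   ∎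

sgn-∸ : ∀ {k n} → k ≤ n → sgn (n ∸ k) ≡ sgn n * sgn k
sgn-∸ {k} {n} k≤n = begin
  sgn (n ∸ k)                     ≡⟨ sgn-cancel k (sgn (n ∸ k)) ⟨
  sgn k * (sgn k * sgn (n ∸ k))   ≡⟨ cong (sgn k *_) (sgn-+ k (n ∸ k)) ⟨
  sgn k * sgn (k ℕ.+ (n ∸ k))     ≡⟨ cong (λ m → sgn k * sgn m) (ℕ.m+[n∸m]≡n k≤n) ⟩
  sgn k * sgn n                   ≡⟨ ℤ.*-comm (sgn k) (sgn n) ⟩
  sgn n * sgn k                   ∎

neg-^ : ∀ (x : ℤ) n → (- x) ℤ.^ n ≡ sgn n * x ℤ.^ n
neg-^ x zero    = refl
neg-^ x (suc n) = trans (cong ((- x) *_) (neg-^ x n)) (reassoc x (sgn n) (x ℤ.^ n))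
  where
  reassoc : ∀ (x s e : ℤ) → (- x) * (s * e) ≡ (- s) * (x * e)
  reassoc = solve-∀

pos-^ : ∀ m n → + (m ^ n) ≡ (+ m) ℤ.^ n
pos-^ m zero    = refl
pos-^ m (suc n) = trans (ℤ.pos-* m (m ^ n)) (cong (+ m *_) (pos-^ m n))

x*0*y≡0 : ∀ (x y : ℤ) → x * + 0 * y ≡ + 0
x*0*y≡0 x y = trans (cong (_* y) (ℤ.*-zeroʳ x)) (ℤ.*-zeroˡ y)

[1+k]*[1+n]C[1+k]≡[1+n]*nCk : ∀ n k → suc k ℕ.* (suc n C suc k) ≡ suc n ℕ.* (n C k)
[1+k]*[1+n]C[1+k]≡[1+n]*nCk zero zero = refl
[1+k]*[1+n]C[1+k]≡[1+n]*nCk zero (suc k) =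
  trans (cong (suc (suc k) ℕ.*_) (k>n⇒nCk≡0 {1} {suc (suc k)} (s≤s (s≤s ℕ.z≤n)))) (ℕ.*-zeroʳ (suc (suc k)))
[1+k]*[1+n]C[1+k]≡[1+n]*nCk (suc n) zero =
  trans (ℕ.*-identityˡ _) (trans (nC1≡n (suc (suc n))) (sym (ℕ.*-identityʳ (suc (suc n)))))
[1+k]*[1+n]C[1+k]≡[1+n]*nCk (suc n) (suc k) = begin
  suc (suc k) ℕ.* (suc (suc n) C suc (suc k))
    ≡⟨ cong (suc (suc k) ℕ.*_) (nCk+nC[k+1]≡[n+1]C[k+1] (suc n) (suc k)) ⟨
  suc (suc k) ℕ.* (suc n C suc k ℕ.+ suc n C suc (suc k))
    ≡⟨ split (suc k) (suc n C suc k) (suc n C suc (suc k)) ⟩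
  suc k ℕ.* (suc n C suc k) ℕ.+ suc n C suc k ℕ.+ suc (suc k) ℕ.* (suc n C suc (suc k))
    ≡⟨ cong₂ (λ a b → a ℕ.+ suc n C suc k ℕ.+ b)
             ([1+k]*[1+n]C[1+k]≡[1+n]*nCk n k) ([1+k]*[1+n]C[1+k]≡[1+n]*nCk n (suc k)) ⟩
  suc n ℕ.* (n C k) ℕ.+ suc n C suc k ℕ.+ suc n ℕ.* (n C suc k)
    ≡⟨ cong (λ c → suc n ℕ.* (n C k) ℕ.+ c ℕ.+ suc n ℕ.* (n C suc k))
            (nCk+nC[k+1]≡[n+1]C[k+1] n k) ⟨
  suc n ℕ.* (n C k) ℕ.+ (n C k ℕ.+ n C suc k) ℕ.+ suc n ℕ.* (n C suc k)
    ≡⟨ merge (suc n) (n C k) (n C suc k) ⟩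
  suc (suc n) ℕ.* (n C k ℕ.+ n C suc k)
    ≡⟨ cong (suc (suc n) ℕ.*_) (nCk+nC[k+1]≡[n+1]C[k+1] n k) ⟩
  suc (suc n) ℕ.* (suc n C suc k) ∎
  where
  split : ∀ k x y → suc k ℕ.* (x ℕ.+ y) ≡ k ℕ.* x ℕ.+ x ℕ.+ suc k ℕ.* y
  split = ℕ-Solver.solve-∀
  merge : ∀ m x y → m ℕ.* x ℕ.+ (x ℕ.+ y) ℕ.+ m ℕ.* y ≡ suc m ℕ.* (x ℕ.+ y)
  merge = ℕ-Solver.solve-∀

k>n⇒Snk≡0 : ∀ {n k} → n < k → S n k ≡ 0
k>n⇒Snk≡0 {zero}  {suc k} _ = refl
k>n⇒Snk≡0 {suc n} {suc k} (s≤s n<k)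
  rewrite k>n⇒Snk≡0 {n} {suc k} (ℕ.m<n⇒m<1+n n<k) | k>n⇒Snk≡0 n<k = trans (ℕ.+-identityʳ _) (ℕ.*-zeroʳ k)

k>n⇒Lnk≡0 : ∀ {n k} → n < k → L n k ≡ 0
k>n⇒Lnk≡0 {zero}  {suc k} _ = refl
k>n⇒Lnk≡0 {suc n} {suc k} (s≤s n<k) rewrite k>n⇒nCk≡0 n<k =
  ℕ.*-zeroʳ ((suc n ! / suc k !) {{suc k !≢0}})

[1+k]!*L≡[1+n]!*nCk : ∀ n k → suc k ! ℕ.* L (suc n) (suc k) ≡ suc n ! ℕ.* (n C k)
[1+k]!*L≡[1+n]!*nCk n k with k ℕ.≤? n
... | yes k≤n = begin
  suc k ! ℕ.* ((suc n ! / suc k !) ℕ.* (n C k)) ≡⟨ ℕ.*-assoc (suc k !) _ (n C k) ⟨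
  suc k ! ℕ.* (suc n ! / suc k !) ℕ.* (n C k)   ≡⟨ cong (ℕ._* (n C k)) (m*[n/m]≡n (m≤n⇒m!∣n! (s≤s k≤n))) ⟩
  suc n ! ℕ.* (n C k)                          ∎
  where instance _ = suc k !≢0
... | no k≰n rewrite k>n⇒nCk≡0 (ℕ.≰⇒> k≰n) = begin
  suc k ! ℕ.* ((suc n ! / suc k !) {{suc k !≢0}} ℕ.* 0) ≡⟨ cong (suc k ! ℕ.*_) (ℕ.*-zeroʳ ((suc n ! / suc k !) {{suc k !≢0}})) ⟩
  suc k ! ℕ.* 0                                        ≡⟨ ℕ.*-zeroʳ (suc k !) ⟩
  0                                                    ≡⟨ ℕ.*-zeroʳ (suc n !) ⟨
  suc n ! ℕ.* 0                                        ∎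

L[1+n,1]≡[1+n]! : ∀ n → L (suc n) 1 ≡ suc n !
L[1+n,1]≡[1+n]! n = trans (ℕ.*-identityʳ _) (n/1≡n (suc n !))

lah-binomial : ∀ m r → suc (suc m) ℕ.* (suc m C suc r)
                       ≡ (suc m ℕ.+ suc (suc r)) ℕ.* (m C suc r) ℕ.+ suc (suc r) ℕ.* (m C r)
lah-binomial m r = begin
  suc (suc m) ℕ.* (suc m C suc r)                   ≡⟨ cong (suc (suc m) ℕ.*_) (nCk+nC[k+1]≡[n+1]C[k+1] m r) ⟨
  suc (suc m) ℕ.* (Y ℕ.+ X)                         ≡⟨ expand m X Y ⟩
  suc m ℕ.* Y ℕ.+ Y ℕ.+ suc (suc m) ℕ.* X           ≡⟨ cong (λ z → z ℕ.+ Y ℕ.+ suc (suc m) ℕ.* X) absorb ⟨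
  suc r ℕ.* (Y ℕ.+ X) ℕ.+ Y ℕ.+ suc (suc m) ℕ.* X   ≡⟨ collect m r X Y ⟩
  (suc m ℕ.+ suc (suc r)) ℕ.* X ℕ.+ suc (suc r) ℕ.* Y ∎
  where
  X : ℕ
  X = m C suc r
  Y : ℕ
  Y = m C r
  absorb : suc r ℕ.* (Y ℕ.+ X) ≡ suc m ℕ.* Y
  absorb = trans (cong (suc r ℕ.*_) (nCk+nC[k+1]≡[n+1]C[k+1] m r)) ([1+k]*[1+n]C[1+k]≡[1+n]*nCk m r)
  expand : ∀ m X Y → suc (suc m) ℕ.* (Y ℕ.+ X) ≡ suc m ℕ.* Y ℕ.+ Y ℕ.+ suc (suc m) ℕ.* X
  expand = ℕ-Solver.solve-∀
  collect : ∀ m r X Y → suc r ℕ.* (Y ℕ.+ X) ℕ.+ Y ℕ.+ suc (suc m) ℕ.* X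
                        ≡ (suc m ℕ.+ suc (suc r)) ℕ.* X ℕ.+ suc (suc r) ℕ.* Y
  collect = ℕ-Solver.solve-∀

L-rec : ∀ k q → L (suc k) (suc q) ≡ (k ℕ.+ suc q) ℕ.* L k (suc q) ℕ.+ L k q
L-rec zero    zero    = refl
L-rec zero    (suc q) rewrite k>n⇒Lnk≡0 {1} {suc (suc q)} (s≤s (s≤s ℕ.z≤n)) =
  sym (trans (ℕ.+-identityʳ _) (ℕ.*-zeroʳ (suc (suc q))))
L-rec (suc m) zero    rewrite L[1+n,1]≡[1+n]! (suc m) | L[1+n,1]≡[1+n]! m =
  sym (trans (ℕ.+-identityʳ _) (cong (ℕ._* suc m !) (ℕ.+-comm (suc m) 1)))
L-rec (suc m) (suc r) = ℕ.*-cancelˡ-≡ _ _ (suc (suc r) !) {{suc (suc r) !≢0}} (begin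
  suc (suc r) ! ℕ.* L (suc (suc m)) (suc (suc r))         ≡⟨ [1+k]!*L≡[1+n]!*nCk (suc m) (suc r) ⟩
  suc (suc m) ! ℕ.* (suc m C suc r)                       ≡⟨ factor m (suc m !) (suc m C suc r) ⟩
  suc m ! ℕ.* (suc (suc m) ℕ.* (suc m C suc r))           ≡⟨ cong (suc m ! ℕ.*_) (lah-binomial m r) ⟩
  suc m ! ℕ.* (K ℕ.* (m C suc r) ℕ.+ suc (suc r) ℕ.* (m C r))
    ≡⟨ distribute K (suc (suc r)) (suc m !) (m C suc r) (m C r) ⟩
  K ℕ.* (suc m ! ℕ.* (m C suc r)) ℕ.+ suc (suc r) ℕ.* (suc m ! ℕ.* (m C r))
    ≡⟨ cong₂ (λ a b → K ℕ.* a ℕ.+ suc (suc r) ℕ.* b)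
             ([1+k]!*L≡[1+n]!*nCk m (suc r)) ([1+k]!*L≡[1+n]!*nCk m r) ⟨
  K ℕ.* (suc (suc r) ! ℕ.* L (suc m) (suc (suc r))) ℕ.+ suc (suc r) ℕ.* (suc r ! ℕ.* L (suc m) (suc r))
    ≡⟨ regroup K (suc (suc r)) (suc r !) (L (suc m) (suc (suc r))) (L (suc m) (suc r)) ⟩
  suc (suc r) ! ℕ.* (K ℕ.* L (suc m) (suc (suc r)) ℕ.+ L (suc m) (suc r)) ∎)
  where
  K : ℕ
  K = suc m ℕ.+ suc (suc r)
  factor : ∀ m F c → suc (suc m) ℕ.* F ℕ.* c ≡ F ℕ.* (suc (suc m) ℕ.* c)
  factor = ℕ-Solver.solve-∀
  distribute : ∀ a b F x y → F ℕ.* (a ℕ.* x ℕ.+ b ℕ.* y) ≡ a ℕ.* (F ℕ.* x) ℕ.+ b ℕ.* (F ℕ.* y)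
  distribute = ℕ-Solver.solve-∀
  regroup : ∀ a c G u v → a ℕ.* (c ℕ.* G ℕ.* u) ℕ.+ c ℕ.* (G ℕ.* v) ≡ c ℕ.* G ℕ.* (a ℕ.* u ℕ.+ v)
  regroup = ℕ-Solver.solve-∀

∑SL : ℕ → ℕ → ℤ
∑SL n p = ∑ (suc n) (λ k → + (S n k) * + (L k p) * sgn k)

∑SL-suc : ∀ n p → ∑SL (suc n) p ≡ ∑ (suc n) (λ k → + S n k * (+ k * + L k p - + L (suc k) p) * sgn k)
∑SL-suc n p = begin
  ∑SL (suc n) p                                      ≡⟨ ∑-suc (suc n) (t (suc n)) ⟩
  t (suc n) 0 + ∑ (suc n) (λ i → t (suc n) (suc i))  ≡⟨ cong₂ _+_ (x*0*y≡0 (+ S (suc n) 0) (sgn 0)) (∑-cong (suc n) S-rec) ⟩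
  + 0 + ∑ (suc n) (λ i → w (suc i) + v i)            ≡⟨ ℤ.+-identityˡ _ ⟩
  ∑ (suc n) (λ i → w (suc i) + v i)                  ≡⟨ ∑-distrib-+ (suc n) (λ i → w (suc i)) v ⟩
  ∑ (suc n) (λ i → w (suc i)) + ∑ (suc n) v          ≡⟨ cong (_+ ∑ (suc n) v) shift ⟩
  ∑ (suc n) w + ∑ (suc n) v                          ≡⟨ ∑-distrib-+ (suc n) w v ⟨
  ∑ (suc n) (λ k → w k + v k)                        ≡⟨ ∑-cong (suc n) combine ⟩
  ∑ (suc n) (λ k → + S n k * (+ k * + L k p - + L (suc k) p) * sgn k) ∎
  where
  t : ℕ → ℕ → ℤ
  t m k = + S m k * + L k p * sgn k
  w v : ℕ → ℤ
  w k = + k * t n k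
  v k = + S n k * + L (suc k) p * sgn (suc k)
  S-rec : ∀ i → t (suc n) (suc i) ≡ w (suc i) + v i
  S-rec i = begin
    + (suc i ℕ.* S n (suc i) ℕ.+ S n i) * l * sgn (suc i)
      ≡⟨ cong (λ z → z * l * sgn (suc i)) (ℤ.pos-+ (suc i ℕ.* S n (suc i)) (S n i)) ⟩
    (+ (suc i ℕ.* S n (suc i)) + + S n i) * l * sgn (suc i)
      ≡⟨ cong (λ z → (z + + S n i) * l * sgn (suc i)) (ℤ.pos-* (suc i) (S n (suc i))) ⟩
    (+ suc i * + S n (suc i) + + S n i) * l * sgn (suc i)
      ≡⟨ distribute (+ suc i) (+ S n (suc i)) (+ S n i) l (sgn (suc i)) ⟩
    w (suc i) + v i ∎
    where
    l : ℤ
    l = + L (suc i) p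
    distribute : ∀ (a b c l s : ℤ) → (a * b + c) * l * s ≡ a * (b * l * s) + c * l * s
    distribute = solve-∀
  shift : ∑ (suc n) (λ i → w (suc i)) ≡ ∑ (suc n) w
  shift = begin
    ∑ (suc n) (λ i → w (suc i))          ≡⟨ ℤ.+-identityˡ _ ⟨
    + 0 + ∑ (suc n) (λ i → w (suc i))    ≡⟨ cong (_+ ∑ (suc n) (λ i → w (suc i))) (ℤ.*-zeroˡ (t n 0)) ⟨
    w 0 + ∑ (suc n) (λ i → w (suc i))    ≡⟨ ∑-suc (suc n) w ⟨
    ∑ (suc (suc n)) w                    ≡⟨ ∑-dropLast (suc n) w w[1+n]≡0 ⟩
    ∑ (suc n) w                          ∎
    where
    w[1+n]≡0 : w (suc n) ≡ + 0
    w[1+n]≡0 rewrite k>n⇒Snk≡0 (ℕ.n<1+n n) = ℤ.*-zeroʳ (+ suc n)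
  combine : ∀ k → w k + v k ≡ + S n k * (+ k * + L k p - + L (suc k) p) * sgn k
  combine k = collect (+ k) (+ S n k) (+ L k p) (+ L (suc k) p) (sgn k)
    where
    collect : ∀ (K s l l′ g : ℤ) → K * (s * l * g) + s * l′ * (- g) ≡ s * (K * l - l′) * g
    collect = solve-∀

L-defect-zero : ∀ k → + k * + L k 0 - + L (suc k) 0 ≡ + 0
L-defect-zero zero    = refl
L-defect-zero (suc k) = trans (ℤ.+-identityʳ (+ suc k * + 0)) (ℤ.*-zeroʳ (+ suc k))

L-defect-suc : ∀ k q → + k * + L k (suc q) - + L (suc k) (suc q) ≡ - (+ suc q * + L k (suc q) + + L k q)
L-defect-suc k q = begin
  + k * + L k (suc q) - + L (suc k) (suc q)
    ≡⟨ cong (λ z → + k * + L k (suc q) - z) (cong +_ (L-rec k q)) ⟩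
  + k * + L k (suc q) - + ((k ℕ.+ suc q) ℕ.* L k (suc q) ℕ.+ L k q)
    ≡⟨ cong (λ z → + k * + L k (suc q) - z) (ℤ.pos-+ _ (L k q)) ⟩
  + k * + L k (suc q) - (+ ((k ℕ.+ suc q) ℕ.* L k (suc q)) + + L k q)
    ≡⟨ cong (λ z → + k * + L k (suc q) - (z + + L k q)) (ℤ.pos-* (k ℕ.+ suc q) (L k (suc q))) ⟩
  + k * + L k (suc q) - (+ (k ℕ.+ suc q) * + L k (suc q) + + L k q)
    ≡⟨ cong (λ z → + k * + L k (suc q) - (z * + L k (suc q) + + L k q)) (ℤ.pos-+ k (suc q)) ⟩
  + k * + L k (suc q) - ((+ k + + suc q) * + L k (suc q) + + L k q)
    ≡⟨ cancel (+ k) (+ suc q) (+ L k (suc q)) (+ L k q) ⟩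
  - (+ suc q * + L k (suc q) + + L k q) ∎
  where
  cancel : ∀ (K Q a b : ℤ) → K * a - ((K + Q) * a + b) ≡ - (Q * a + b)
  cancel = solve-∀

∑SL≡sgn*S : ∀ n p → ∑SL n p ≡ sgn n * + S n p
∑SL≡sgn*S zero    zero    = refl
∑SL≡sgn*S zero    (suc p) = refl
∑SL≡sgn*S (suc n) zero    = begin
  ∑SL (suc n) 0 ≡⟨ ∑SL-suc n 0 ⟩
  ∑ (suc n) (λ k → + S n k * (+ k * + L k 0 - + L (suc k) 0) * sgn k)
    ≡⟨ ∑-zero (suc n) _ (λ k _ → trans (cong (λ z → + S n k * z * sgn k) (L-defect-zero k)) (x*0*y≡0 (+ S n k) (sgn k))) ⟩
  + 0           ≡⟨ ℤ.*-zeroʳ (sgn (suc n)) ⟨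
  sgn (suc n) * + 0 ∎
∑SL≡sgn*S (suc n) (suc q) = begin
  ∑SL (suc n) (suc q) ≡⟨ ∑SL-suc n (suc q) ⟩
  ∑ (suc n) (λ k → + S n k * (+ k * + L k (suc q) - + L (suc k) (suc q)) * sgn k)
    ≡⟨ ∑-cong (suc n) (λ k → cong (λ z → + S n k * z * sgn k) (L-defect-suc k q)) ⟩
  ∑ (suc n) (λ k → + S n k * - (Q * + L k (suc q) + + L k q) * sgn k)
    ≡⟨ ∑-cong (suc n) (λ k → split Q (+ S n k) (+ L k (suc q)) (+ L k q) (sgn k)) ⟩
  ∑ (suc n) (λ k → - (Q * t (suc q) k + t q k))
    ≡⟨ neg-distrib-∑ (suc n) _ ⟩
  - ∑ (suc n) (λ k → Q * t (suc q) k + t q k)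
    ≡⟨ cong -_ (∑-distrib-+ (suc n) _ (t q)) ⟩
  - (∑ (suc n) (λ k → Q * t (suc q) k) + ∑SL n q)
    ≡⟨ cong (λ z → - (z + ∑SL n q)) (*-distribˡ-∑ (suc n) Q (t (suc q))) ⟩
  - (Q * ∑SL n (suc q) + ∑SL n q)
    ≡⟨ cong₂ (λ a b → - (Q * a + b)) (∑SL≡sgn*S n (suc q)) (∑SL≡sgn*S n q) ⟩
  - (Q * (sgn n * + S n (suc q)) + sgn n * + S n q)
    ≡⟨ factor Q (sgn n) (+ S n (suc q)) (+ S n q) ⟩
  (- sgn n) * (Q * + S n (suc q) + + S n q)
    ≡⟨ cong (λ z → (- sgn n) * (z + + S n q)) (ℤ.pos-* (suc q) (S n (suc q))) ⟨
  (- sgn n) * (+ (suc q ℕ.* S n (suc q)) + + S n q)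
    ≡⟨ cong ((- sgn n) *_) (ℤ.pos-+ (suc q ℕ.* S n (suc q)) (S n q)) ⟨
  sgn (suc n) * + S (suc n) (suc q) ∎
  where
  Q : ℤ
  Q = + suc q
  t : ℕ → ℕ → ℤ
  t p k = + S n k * + L k p * sgn k
  split : ∀ (Q s l l′ g : ℤ) → s * - (Q * l + l′) * g ≡ - (Q * (s * l * g) + s * l′ * g)
  split = solve-∀
  factor : ∀ (Q s x y : ℤ) → - (Q * (s * x) + s * y) ≡ (- s) * (Q * x + y)
  factor = solve-∀

-- For x = + r this is the r-Stirling number S_r(n + r, p + r).
rStirling : ℤ → ℕ → ℕ → ℤ
rStirling x n p = ∑ (suc n) (λ k → + (n C k) * + S k p * x ℤ.^ (n ∸ k))

rStirling-suc : ∀ x n p → rStirling x (suc n) p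
                ≡ x * rStirling x n p + ∑ (suc n) (λ k → + (n C k) * + S (suc k) p * x ℤ.^ (n ∸ k))
rStirling-suc x n p = begin
  rStirling x (suc n) p                                  ≡⟨ ∑-suc (suc n) f ⟩
  f 0 + ∑ (suc n) (λ i → f (suc i))                      ≡⟨ cong (λ z → f 0 + z) (∑-cong (suc n) pascal) ⟩
  f 0 + ∑ (suc n) (λ i → g i + h i)                      ≡⟨ cong (λ z → f 0 + z) (∑-distrib-+ (suc n) g h) ⟩
  f 0 + (∑ (suc n) g + ∑ (suc n) h)                      ≡⟨ ℤ.+-assoc (f 0) _ _ ⟨
  (f 0 + ∑ (suc n) g) + ∑ (suc n) h                      ≡⟨ cong (_+ ∑ (suc n) h) (∑-suc (suc n) G) ⟨
  ∑ (suc (suc n)) G + ∑ (suc n) h                        ≡⟨ cong (_+ ∑ (suc n) h) (∑-dropLast (suc n) G G[1+n]≡0) ⟩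
  ∑ (suc n) G + ∑ (suc n) h                              ≡⟨ cong (_+ ∑ (suc n) h) (∑-cong< (suc n) G≡x*) ⟩
  ∑ (suc n) (λ k → x * (+ (n C k) * + S k p * x ℤ.^ (n ∸ k))) + ∑ (suc n) h
    ≡⟨ cong (_+ ∑ (suc n) h) (*-distribˡ-∑ (suc n) x _) ⟩
  x * rStirling x n p + ∑ (suc n) h                      ∎
  where
  f g h G : ℕ → ℤ
  f k = + (suc n C k) * + S k p * x ℤ.^ (suc n ∸ k)
  g i = + (n C suc i) * + S (suc i) p * x ℤ.^ (n ∸ i)
  h i = + (n C i) * + S (suc i) p * x ℤ.^ (n ∸ i)
  G k = + (n C k) * + S k p * x ℤ.^ (suc n ∸ k)
  pascal : ∀ i → f (suc i) ≡ g i + h i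
  pascal i = begin
    + (suc n C suc i) * s * e                   ≡⟨ cong (λ c → + c * s * e) (nCk+nC[k+1]≡[n+1]C[k+1] n i) ⟨
    + (n C i ℕ.+ n C suc i) * s * e             ≡⟨ cong (λ c → c * s * e) (ℤ.pos-+ (n C i) (n C suc i)) ⟩
    (+ (n C i) + + (n C suc i)) * s * e         ≡⟨ distribute (+ (n C i)) (+ (n C suc i)) s e ⟩
    g i + h i                                   ∎
    where
    s : ℤ
    s = + S (suc i) p
    e : ℤ
    e = x ℤ.^ (n ∸ i)
    distribute : ∀ (a b s e : ℤ) → (a + b) * s * e ≡ b * s * e + a * s * e
    distribute = solve-∀
  G[1+n]≡0 : G (suc n) ≡ + 0
  G[1+n]≡0 rewrite k>n⇒nCk≡0 (ℕ.n<1+n n) = ℤ.*-zeroˡ (x ℤ.^ (suc n ∸ suc n))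
  G≡x* : ∀ k → k < suc n → G k ≡ x * (+ (n C k) * + S k p * x ℤ.^ (n ∸ k))
  G≡x* k (s≤s k≤n) = begin
    + (n C k) * + S k p * x ℤ.^ (suc n ∸ k)        ≡⟨ cong (λ m → + (n C k) * + S k p * x ℤ.^ m) (ℕ.+-∸-assoc 1 k≤n) ⟩
    + (n C k) * + S k p * (x * x ℤ.^ (n ∸ k))      ≡⟨ pull (+ (n C k)) (+ S k p) x (x ℤ.^ (n ∸ k)) ⟩
    x * (+ (n C k) * + S k p * x ℤ.^ (n ∸ k))      ∎
    where
    pull : ∀ (a b x e : ℤ) → a * b * (x * e) ≡ x * (a * b * e)
    pull = solve-∀

rStirling[x,n,0]≡xⁿ : ∀ x n → rStirling x n 0 ≡ x ℤ.^ n
rStirling[x,n,0]≡xⁿ x zero    = refl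
rStirling[x,n,0]≡xⁿ x (suc n) = begin
  rStirling x (suc n) 0                                                 ≡⟨ rStirling-suc x n 0 ⟩
  x * rStirling x n 0 + ∑ (suc n) (λ k → + (n C k) * + 0 * x ℤ.^ (n ∸ k))
    ≡⟨ cong₂ _+_ (cong (x *_) (rStirling[x,n,0]≡xⁿ x n))
                 (∑-zero (suc n) _ (λ k _ → x*0*y≡0 (+ (n C k)) (x ℤ.^ (n ∸ k)))) ⟩
  x ℤ.^ suc n + + 0                                                     ≡⟨ ℤ.+-identityʳ _ ⟩
  x ℤ.^ suc n                                                           ∎

rStirling-rec : ∀ x n q → rStirling x (suc n) (suc q)
                ≡ (x + + suc q) * rStirling x n (suc q) + rStirling x n q
rStirling-rec x n q = begin
  rStirling x (suc n) (suc q)                    ≡⟨ rStirling-suc x n (suc q) ⟩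
  x * R₁ + ∑ (suc n) (λ k → + (n C k) * + S (suc k) (suc q) * x ℤ.^ (n ∸ k))
    ≡⟨ cong (λ z → x * R₁ + z) (trans (∑-cong (suc n) S-rec) (∑-distrib-+ (suc n) _ _)) ⟩
  x * R₁ + (∑ (suc n) (λ k → Q * t (suc q) k) + rStirling x n q)
    ≡⟨ cong (λ z → x * R₁ + (z + rStirling x n q)) (*-distribˡ-∑ (suc n) Q (t (suc q))) ⟩
  x * R₁ + (Q * R₁ + rStirling x n q)            ≡⟨ collect x Q R₁ (rStirling x n q) ⟩
  (x + Q) * R₁ + rStirling x n q                 ∎
  where
  Q : ℤ
  Q = + suc q
  R₁ : ℤ
  R₁ = rStirling x n (suc q)
  t : ℕ → ℕ → ℤ
  t p k = + (n C k) * + S k p * x ℤ.^ (n ∸ k)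
  S-rec : ∀ k → + (n C k) * + S (suc k) (suc q) * x ℤ.^ (n ∸ k) ≡ Q * t (suc q) k + t q k
  S-rec k = begin
    + (n C k) * + (suc q ℕ.* S k (suc q) ℕ.+ S k q) * e
      ≡⟨ cong (λ z → + (n C k) * z * e) (ℤ.pos-+ (suc q ℕ.* S k (suc q)) (S k q)) ⟩
    + (n C k) * (+ (suc q ℕ.* S k (suc q)) + + S k q) * e
      ≡⟨ cong (λ z → + (n C k) * (z + + S k q) * e) (ℤ.pos-* (suc q) (S k (suc q))) ⟩
    + (n C k) * (Q * + S k (suc q) + + S k q) * e
      ≡⟨ distribute (+ (n C k)) Q (+ S k (suc q)) (+ S k q) e ⟩
    Q * t (suc q) k + t q k ∎
    where
    e : ℤ
    e = x ℤ.^ (n ∸ k)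
    distribute : ∀ (c Q s₁ s₀ e : ℤ) → c * (Q * s₁ + s₀) * e ≡ Q * (c * s₁ * e) + c * s₀ * e
    distribute = solve-∀
  collect : ∀ (x Q a b : ℤ) → x * a + (Q * a + b) ≡ (x + Q) * a + b
  collect = solve-∀

rStirling[0,n,p]≡S : ∀ n p → rStirling (+ 0) n p ≡ + S n p
rStirling[0,n,p]≡S n p = begin
  rStirling (+ 0) n p                                  ≡⟨ cong (_+ f n) (∑-zero n f f≡0) ⟩
  + 0 + f n                                            ≡⟨ ℤ.+-identityˡ (f n) ⟩
  + (n C n) * + S n p * (+ 0) ℤ.^ (n ∸ n)              ≡⟨ cong₂ (λ c m → + c * + S n p * (+ 0) ℤ.^ m) (nCn≡1 n) (ℕ.n∸n≡0 n) ⟩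
  + 1 * + S n p * + 1                                  ≡⟨ trans (ℤ.*-identityʳ _) (ℤ.*-identityˡ _) ⟩
  + S n p                                              ∎
  where
  f : ℕ → ℤ
  f k = + (n C k) * + S k p * (+ 0) ℤ.^ (n ∸ k)
  f≡0 : ∀ k → k < n → f k ≡ + 0
  f≡0 k k<n = begin
    + (n C k) * + S k p * (+ 0) ℤ.^ (n ∸ k)                ≡⟨ cong (λ m → + (n C k) * + S k p * (+ 0) ℤ.^ m) (ℕ.+-∸-assoc 1 k<n) ⟩
    + (n C k) * + S k p * (+ 0 * (+ 0) ℤ.^ (n ∸ suc k))    ≡⟨ ℤ.*-zeroʳ (+ (n C k) * + S k p) ⟩
    + 0                                                    ∎

∇pow : ℤ → ℕ → ℕ → ℤ
∇pow y n p = ∑ (suc p) (λ j → sgn j * + (p C j) * (y - + j) ℤ.^ n)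

∇pow[y,n,0]≡yⁿ : ∀ y n → ∇pow y n 0 ≡ y ℤ.^ n
∇pow[y,n,0]≡yⁿ y n = trans (ℤ.+-identityˡ _) (trans (ℤ.*-identityˡ _) (cong (ℤ._^ n) (ℤ.+-identityʳ y)))

∑-alternating-C : ∀ q → ∑ (suc (suc q)) (λ j → sgn j * + (suc q C j)) ≡ + 0
∑-alternating-C q = begin
  ∑ (suc (suc q)) (λ j → sgn j * + (suc q C j))   ≡⟨ ∑-cong (suc (suc q)) pascal ⟩
  ∑ (suc (suc q)) (λ j → f (suc j) - f j)         ≡⟨ ∑-telescope (suc (suc q)) f ⟩
  sgn (suc q) * + (q C suc q) - + 0               ≡⟨ cong (λ c → sgn (suc q) * + c - + 0) (k>n⇒nCk≡0 (ℕ.n<1+n q)) ⟩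
  sgn (suc q) * + 0 - + 0                         ≡⟨ cong (_- + 0) (ℤ.*-zeroʳ (sgn (suc q))) ⟩
  + 0                                             ∎
  where
  f : ℕ → ℤ
  f zero    = + 0
  f (suc j) = sgn j * + (q C j)
  pascal : ∀ j → sgn j * + (suc q C j) ≡ f (suc j) - f j
  pascal zero    = refl
  pascal (suc i) = begin
    sgn (suc i) * + (suc q C suc i)             ≡⟨ cong (λ c → sgn (suc i) * + c) (nCk+nC[k+1]≡[n+1]C[k+1] q i) ⟨
    (- sgn i) * + (q C i ℕ.+ q C suc i)         ≡⟨ cong ((- sgn i) *_) (ℤ.pos-+ (q C i) (q C suc i)) ⟩
    (- sgn i) * (+ (q C i) + + (q C suc i))     ≡⟨ distribute (sgn i) (+ (q C i)) (+ (q C suc i)) ⟩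
    f (suc (suc i)) - f (suc i)                 ∎
    where
    distribute : ∀ (s a b : ℤ) → (- s) * (a + b) ≡ (- s) * b - s * a
    distribute = solve-∀

∇pow[y,0,1+q]≡0 : ∀ y q → ∇pow y 0 (suc q) ≡ + 0
∇pow[y,0,1+q]≡0 y q = trans (∑-cong (suc (suc q)) (λ j → ℤ.*-identityʳ _)) (∑-alternating-C q)

∇pow-rec : ∀ y n q → ∇pow y (suc n) (suc q) ≡ y * ∇pow y n (suc q) + + suc q * ∇pow (y - + 1) n q
∇pow-rec y n q = begin
  ∇pow y (suc n) (suc q)                                       ≡⟨ ∑-cong (suc (suc q)) split ⟩
  ∑ (suc (suc q)) (λ j → y * t j + (- + j) * t j)              ≡⟨ ∑-distrib-+ (suc (suc q)) _ _ ⟩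
  ∑ (suc (suc q)) (λ j → y * t j) + ∑ (suc (suc q)) (λ j → (- + j) * t j)
    ≡⟨ cong₂ _+_ (*-distribˡ-∑ (suc (suc q)) y t) (∑-suc (suc q) _) ⟩
  y * ∇pow y n (suc q) + ((- + 0) * t 0 + ∑ (suc q) (λ i → (- + suc i) * t (suc i)))
    ≡⟨ cong (λ z → y * ∇pow y n (suc q) + (z + ∑ (suc q) (λ i → (- + suc i) * t (suc i)))) (ℤ.*-zeroˡ (t 0)) ⟩
  y * ∇pow y n (suc q) + (+ 0 + ∑ (suc q) (λ i → (- + suc i) * t (suc i)))
    ≡⟨ cong (λ z → y * ∇pow y n (suc q) + z) (trans (ℤ.+-identityˡ _) (∑-cong (suc q) absorb)) ⟩
  y * ∇pow y n (suc q) + ∑ (suc q) (λ i → Q * (sgn i * + (q C i) * ((y - + 1) - + i) ℤ.^ n))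
    ≡⟨ cong (λ z → y * ∇pow y n (suc q) + z) (*-distribˡ-∑ (suc q) Q _) ⟩
  y * ∇pow y n (suc q) + Q * ∇pow (y - + 1) n q ∎
  where
  Q : ℤ
  Q = + suc q
  t : ℕ → ℤ
  t j = sgn j * + (suc q C j) * (y - + j) ℤ.^ n
  split : ∀ j → sgn j * + (suc q C j) * (y - + j) ℤ.^ suc n ≡ y * t j + (- + j) * t j
  split j = distribute (sgn j) (+ (suc q C j)) y (+ j) ((y - + j) ℤ.^ n)
    where
    distribute : ∀ (s c y J e : ℤ) → s * c * ((y - J) * e) ≡ y * (s * c * e) + (- J) * (s * c * e)
    distribute = solve-∀
  absorb : ∀ i → (- + suc i) * t (suc i) ≡ Q * (sgn i * + (q C i) * ((y - + 1) - + i) ℤ.^ n)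
  absorb i = begin
    (- + suc i) * ((- sgn i) * + (suc q C suc i) * (y - + suc i) ℤ.^ n)
      ≡⟨ negate (+ suc i) (sgn i) (+ (suc q C suc i)) ((y - + suc i) ℤ.^ n) ⟩
    sgn i * (+ suc i * + (suc q C suc i)) * (y - + suc i) ℤ.^ n
      ≡⟨ cong₂ (λ c z → sgn i * c * z ℤ.^ n) absorption (shift-sub y (+ i)) ⟩
    sgn i * (Q * + (q C i)) * ((y - + 1) - + i) ℤ.^ n
      ≡⟨ pull Q (sgn i) (+ (q C i)) (((y - + 1) - + i) ℤ.^ n) ⟩
    Q * (sgn i * + (q C i) * ((y - + 1) - + i) ℤ.^ n) ∎
    where
    absorption : + suc i * + (suc q C suc i) ≡ Q * + (q C i)
    absorption = begin
      + suc i * + (suc q C suc i)      ≡⟨ ℤ.pos-* (suc i) (suc q C suc i) ⟨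
      + (suc i ℕ.* (suc q C suc i))    ≡⟨ cong +_ ([1+k]*[1+n]C[1+k]≡[1+n]*nCk q i) ⟩
      + (suc q ℕ.* (q C i))            ≡⟨ ℤ.pos-* (suc q) (q C i) ⟩
      Q * + (q C i)                    ∎
    negate : ∀ (I s c e : ℤ) → (- I) * ((- s) * c * e) ≡ s * (I * c) * e
    negate = solve-∀
    shift-sub : ∀ (y I : ℤ) → y - (+ 1 + I) ≡ (y - + 1) - I
    shift-sub = solve-∀
    pull : ∀ (Q s c e : ℤ) → s * (Q * c) * e ≡ Q * (s * c * e)
    pull = solve-∀

∇pow-reflect : ∀ y n p → ∇pow y n p ≡ sgn p * (sgn n * ∇pow (+ p - y) n p)
∇pow-reflect y n p = begin
  ∇pow y n p                                      ≡⟨ ∑-reverse p t ⟩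
  ∑ (suc p) (λ j → t (p ∸ j))                     ≡⟨ ∑-cong< (suc p) reflect ⟩
  ∑ (suc p) (λ j → sgn p * (sgn n * u j))         ≡⟨ *-distribˡ-∑ (suc p) (sgn p) _ ⟩
  sgn p * ∑ (suc p) (λ j → sgn n * u j)           ≡⟨ cong (sgn p *_) (*-distribˡ-∑ (suc p) (sgn n) u) ⟩
  sgn p * (sgn n * ∇pow (+ p - y) n p)            ∎
  where
  t u : ℕ → ℤ
  t j = sgn j * + (p C j) * (y - + j) ℤ.^ n
  u j = sgn j * + (p C j) * ((+ p - y) - + j) ℤ.^ n
  reflect : ∀ j → j < suc p → t (p ∸ j) ≡ sgn p * (sgn n * u j)
  reflect j (s≤s j≤p) = begin
    sgn (p ∸ j) * + (p C (p ∸ j)) * (y - + (p ∸ j)) ℤ.^ n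
      ≡⟨ cong₂ (λ s c → s * + c * (y - + (p ∸ j)) ℤ.^ n) (sym (sgn-∸ j≤p)) (nCk≡nC[n∸k] j≤p) ⟨
    sgn p * sgn j * + (p C j) * (y - + (p ∸ j)) ℤ.^ n
      ≡⟨ cong (λ z → sgn p * sgn j * + (p C j) * z ℤ.^ n) y-[p∸j] ⟩
    sgn p * sgn j * + (p C j) * (- ((+ p - y) - + j)) ℤ.^ n
      ≡⟨ cong (sgn p * sgn j * + (p C j) *_) (neg-^ ((+ p - y) - + j) n) ⟩
    sgn p * sgn j * + (p C j) * (sgn n * ((+ p - y) - + j) ℤ.^ n)
      ≡⟨ regroup (sgn p) (sgn j) (+ (p C j)) (sgn n) (((+ p - y) - + j) ℤ.^ n) ⟩
    sgn p * (sgn n * u j) ∎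
    where
    y-[p∸j] : y - + (p ∸ j) ≡ - ((+ p - y) - + j)
    y-[p∸j] = begin
      y - + (p ∸ j)                           ≡⟨ cancel y (+ j) (+ (p ∸ j)) ⟩
      - ((+ j + + (p ∸ j) - y) - + j)         ≡⟨ cong (λ z → - ((z - y) - + j)) (ℤ.pos-+ j (p ∸ j)) ⟨
      - ((+ (j ℕ.+ (p ∸ j)) - y) - + j)       ≡⟨ cong (λ m → - ((+ m - y) - + j)) (ℕ.m+[n∸m]≡n j≤p) ⟩
      - ((+ p - y) - + j)                     ∎
      where
      cancel : ∀ (y J D : ℤ) → y - D ≡ - ((J + D - y) - J)
      cancel = solve-∀
    regroup : ∀ (σ s c ν e : ℤ) → σ * s * c * (ν * e) ≡ σ * (ν * (s * c * e))
    regroup = solve-∀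

p!*rStirling≡∇pow : ∀ x n p → + (p !) * rStirling x n p ≡ ∇pow (x + + p) n p
p!*rStirling≡∇pow x n zero = begin
  + 1 * rStirling x n 0     ≡⟨ ℤ.*-identityˡ _ ⟩
  rStirling x n 0           ≡⟨ rStirling[x,n,0]≡xⁿ x n ⟩
  x ℤ.^ n                   ≡⟨ cong (ℤ._^ n) (ℤ.+-identityʳ x) ⟨
  (x + + 0) ℤ.^ n           ≡⟨ ∇pow[y,n,0]≡yⁿ (x + + 0) n ⟨
  ∇pow (x + + 0) n 0        ∎
p!*rStirling≡∇pow x zero (suc q) = begin
  + (suc q !) * rStirling x 0 (suc q) ≡⟨⟩
  + (suc q !) * + 0                   ≡⟨ ℤ.*-zeroʳ (+ (suc q !)) ⟩
  + 0                                 ≡⟨ ∇pow[y,0,1+q]≡0 (x + + suc q) q ⟨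
  ∇pow (x + + suc q) 0 (suc q)        ∎
p!*rStirling≡∇pow x (suc n) (suc q) = begin
  + (suc q !) * rStirling x (suc n) (suc q)            ≡⟨ cong (+ (suc q !) *_) (rStirling-rec x n q) ⟩
  + (suc q !) * ((x + Q) * R₁ + R₀)                    ≡⟨ cong (_* ((x + Q) * R₁ + R₀)) (ℤ.pos-* (suc q) (q !)) ⟩
  Q * + (q !) * ((x + Q) * R₁ + R₀)                    ≡⟨ distribute Q (+ (q !)) (x + Q) R₁ R₀ ⟩
  (x + Q) * (Q * + (q !) * R₁) + Q * (+ (q !) * R₀)
    ≡⟨ cong₂ (λ a b → (x + Q) * a + Q * b)
             (trans (cong (_* R₁) (sym (ℤ.pos-* (suc q) (q !)))) (p!*rStirling≡∇pow x n (suc q)))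
             (p!*rStirling≡∇pow x n q) ⟩
  (x + Q) * ∇pow (x + Q) n (suc q) + Q * ∇pow (x + + q) n q
    ≡⟨ cong (λ y → (x + Q) * ∇pow (x + Q) n (suc q) + Q * ∇pow y n q) x+q≡x+Q-1 ⟩
  (x + Q) * ∇pow (x + Q) n (suc q) + Q * ∇pow ((x + Q) - + 1) n q ≡⟨ ∇pow-rec (x + Q) n q ⟨
  ∇pow (x + Q) (suc n) (suc q) ∎
  where
  Q : ℤ
  Q = + suc q
  R₁ R₀ : ℤ
  R₁ = rStirling x n (suc q)
  R₀ = rStirling x n q
  distribute : ∀ (Q F y a b : ℤ) → Q * F * (y * a + b) ≡ y * (Q * F * a) + Q * (F * b)
  distribute = solve-∀
  x+q≡x+Q-1 : x + + q ≡ (x + Q) - + 1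
  x+q≡x+Q-1 = trans (shift x (+ q)) (cong (λ z → (x + z) - + 1) (sym (ℤ.pos-+ 1 q)))
    where
    shift : ∀ (x q : ℤ) → x + q ≡ (x + (+ 1 + q)) - + 1
    shift = solve-∀

S≡±rStirling : ∀ n p → + S n p ≡ sgn p * (sgn n * rStirling (- + p) n p)
S≡±rStirling n p = ℤ.*-cancelˡ-≡ (+ (p !)) _ _ {{p !≢0}} (begin
  + (p !) * + S n p                             ≡⟨ cong (+ (p !) *_) (rStirling[0,n,p]≡S n p) ⟨
  + (p !) * rStirling (+ 0) n p                 ≡⟨ p!*rStirling≡∇pow (+ 0) n p ⟩
  ∇pow (+ 0 + + p) n p                          ≡⟨ cong (λ y → ∇pow y n p) (ℤ.+-identityˡ (+ p)) ⟩
  ∇pow (+ p) n p                                ≡⟨ ∇pow-reflect (+ p) n p ⟩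
  sgn p * (sgn n * ∇pow (+ p - + p) n p)        ≡⟨ cong (λ y → sgn p * (sgn n * ∇pow y n p)) (ℤ.+-comm (+ p) (- + p)) ⟩
  sgn p * (sgn n * ∇pow (- + p + + p) n p)      ≡⟨ cong (λ z → sgn p * (sgn n * z)) (p!*rStirling≡∇pow (- + p) n p) ⟨
  sgn p * (sgn n * (+ (p !) * R))               ≡⟨ regroup (sgn p) (sgn n) (+ (p !)) R ⟩
  + (p !) * (sgn p * (sgn n * R))               ∎)
  where
  R : ℤ
  R = rStirling (- + p) n p
  regroup : ∀ (a b f x : ℤ) → a * (b * (f * x)) ≡ f * (a * (b * x))
  regroup = solve-∀

C-S-term≡0 : ∀ {n k p} (e s : ℤ) → k < p → + (n C k) * + S k p * e * s ≡ + 0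
C-S-term≡0 {n} {k} {p} e s k<p = begin
  + (n C k) * + S k p * e * s  ≡⟨ cong (λ m → + (n C k) * + m * e * s) (k>n⇒Snk≡0 k<p) ⟩
  + (n C k) * + 0 * e * s      ≡⟨ cong (_* s) (x*0*y≡0 (+ (n C k)) e) ⟩
  + 0 * s                      ≡⟨ ℤ.*-zeroˡ s ⟩
  + 0                          ∎

∑CSp^sgn[n∸k]≡rStirling : ∀ n p → p ≤ n →
  sumFromTo p n (λ k → + (n C k) * + S k p * + (p ^ (n ∸ k)) * sgn (n ∸ k)) ≡ rStirling (- + p) n p
∑CSp^sgn[n∸k]≡rStirling n p p≤n =
  trans (sumFromTo≡∑ p n _ p≤n (λ k → C-S-term≡0 _ _)) (∑-cong (suc n) term)
  where
  term : ∀ k → + (n C k) * + S k p * + (p ^ (n ∸ k)) * sgn (n ∸ k) ≡ + (n C k) * + S k p * (- + p) ℤ.^ (n ∸ k)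
  term k = begin
    + (n C k) * + S k p * + (p ^ m) * sgn m           ≡⟨ cong (λ e → + (n C k) * + S k p * e * sgn m) (pos-^ p m) ⟩
    + (n C k) * + S k p * (+ p) ℤ.^ m * sgn m         ≡⟨ reassoc (+ (n C k)) (+ S k p) ((+ p) ℤ.^ m) (sgn m) ⟩
    + (n C k) * + S k p * (sgn m * (+ p) ℤ.^ m)       ≡⟨ cong (+ (n C k) * + S k p *_) (neg-^ (+ p) m) ⟨
    + (n C k) * + S k p * (- + p) ℤ.^ m               ∎
    where
    m : ℕ
    m = n ∸ k
    reassoc : ∀ (c s e σ : ℤ) → c * s * e * σ ≡ c * s * (σ * e)
    reassoc = solve-∀

∑CSp^sgn[k]≡sgn*rStirling : ∀ n p → p ≤ n →
  sumFromTo p n (λ k → + (n C k) * + S k p * + (p ^ (n ∸ k)) * sgn k) ≡ sgn n * rStirling (- + p) n p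
∑CSp^sgn[k]≡sgn*rStirling n p p≤n = begin
  sumFromTo p n t                                                 ≡⟨ sumFromTo≡∑ p n t p≤n (λ k → C-S-term≡0 _ _) ⟩
  ∑ (suc n) t                                                     ≡⟨ ∑-cong< (suc n) term ⟩
  ∑ (suc n) (λ k → sgn n * (+ (n C k) * + S k p * (- + p) ℤ.^ (n ∸ k))) ≡⟨ *-distribˡ-∑ (suc n) (sgn n) _ ⟩
  sgn n * rStirling (- + p) n p                                   ∎
  where
  t : ℕ → ℤ
  t k = + (n C k) * + S k p * + (p ^ (n ∸ k)) * sgn k
  term : ∀ k → k < suc n → t k ≡ sgn n * (+ (n C k) * + S k p * (- + p) ℤ.^ (n ∸ k))
  term k (s≤s k≤n) = begin
    + (n C k) * + S k p * + (p ^ m) * sgn k                     ≡⟨ cong (λ e → + (n C k) * + S k p * e * sgn k) (pos-^ p m) ⟩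
    + (n C k) * + S k p * (+ p) ℤ.^ m * sgn k                   ≡⟨ sgn-cancel n _ ⟨
    sgn n * (sgn n * (+ (n C k) * + S k p * (+ p) ℤ.^ m * sgn k))
      ≡⟨ cong (sgn n *_) (reassoc (sgn n) (+ (n C k)) (+ S k p) ((+ p) ℤ.^ m) (sgn k)) ⟩
    sgn n * (+ (n C k) * + S k p * ((sgn n * sgn k) * (+ p) ℤ.^ m))
      ≡⟨ cong (λ σ → sgn n * (+ (n C k) * + S k p * (σ * (+ p) ℤ.^ m))) (sgn-∸ k≤n) ⟨
    sgn n * (+ (n C k) * + S k p * (sgn m * (+ p) ℤ.^ m))
      ≡⟨ cong (λ e → sgn n * (+ (n C k) * + S k p * e)) (neg-^ (+ p) m) ⟨
    sgn n * (+ (n C k) * + S k p * (- + p) ℤ.^ m)               ∎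
    where
    m : ℕ
    m = n ∸ k
    reassoc : ∀ (ν c s e σ : ℤ) → ν * (c * s * e * σ) ≡ c * s * ((ν * σ) * e)
    reassoc = solve-∀

proposition9 : (n p : ℕ) → p ≤ n →
    (sumFromTo p n (λ k → (+ (S n k)) * (+ (L k p)) * sgn k)
      ≡ sgn p * sumFromTo p n (λ k → (+ (n C k)) * (+ (S k p)) * (+ (p ^ (n ∸ k))) * sgn (n ∸ k)))
    × (+ (S n p)
      ≡ sgn p * sumFromTo p n (λ k → (+ (n C k)) * (+ (S k p)) * (+ (p ^ (n ∸ k))) * sgn k))
proposition9 n p p≤n =
  (begin
    sumFromTo p n (λ k → + S n k * + L k p * sgn k)  ≡⟨ sumFromTo≡∑ p n _ p≤n L-vanishes ⟩
    ∑SL n p                                          ≡⟨ ∑SL≡sgn*S n p ⟩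
    sgn n * + S n p                                  ≡⟨ cong (sgn n *_) (S≡±rStirling n p) ⟩
    sgn n * (sgn p * (sgn n * R))                    ≡⟨ swap (sgn n) (sgn p) (sgn n * R) ⟩
    sgn p * (sgn n * (sgn n * R))                    ≡⟨ cong (sgn p *_) (sgn-cancel n R) ⟩
    sgn p * R                                        ≡⟨ cong (sgn p *_) (∑CSp^sgn[n∸k]≡rStirling n p p≤n) ⟨
    sgn p * sumFromTo p n (λ k → + (n C k) * + S k p * + (p ^ (n ∸ k)) * sgn (n ∸ k)) ∎)
  , trans (S≡±rStirling n p) (cong (sgn p *_) (sym (∑CSp^sgn[k]≡sgn*rStirling n p p≤n)))
  where
  R : ℤ
  R = rStirling (- + p) n p
  L-vanishes : ∀ k → k < p → + S n k * + L k p * sgn k ≡ + 0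
  L-vanishes k k<p = trans (cong (λ l → + S n k * + l * sgn k) (k>n⇒Lnk≡0 k<p)) (x*0*y≡0 (+ S n k) (sgn k))
  swap : ∀ (a b x : ℤ) → a * (b * x) ≡ b * (a * x)
  swap = solve-∀
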